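{- If $((i_1\,j_1),\ldots,(i_k\,j_k))\in\Sigma_n(k)$, then $((n+1-j_k\;\,n+1-i_k),\ldots,(n+1-j_1\;\,n+1-i_1))\in\Sigma_n(k)$.
   Context: Permutations are multiplied with the right factor applied first. $\mathsf T_n$ is the set of transpositions of $\{1,\ldots,n\}$; a transposition is written $(i\,j)$ with $i<j$. For $\sigma\in\mathfrak S_n$, $|\sigma|=n-(\text{number of cycles of }\sigma\text{, fixed points included})$, and $\sigma_1\preccurlyeq\sigma_2$ iff $|\sigma_2|=|\sigma_1|+|\sigma_1^{ -1}\sigma_2|$. $\Sigma_n(k)=\{(\tau_1,\ldots,\tau_k)\in(\mathsf T_n)^k : |\tau_1\cdots\tau_k|=k,\ \tau_1\cdots\tau_k\preccurlyeq(1\,2\,\cdots\,n)\}$. -}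

module Defs where

open import Data.Nat using (ℕ; zero; suc; _+_; _∸_; s≤s; z≤n)
open import Data.Nat.Properties using (∸-monoʳ-<)
open import Data.Bool using (_∧_; Bool; true; false; if_then_else_)
open import Data.Fin using (Fin; zero; suc; toℕ; opposite; fromℕ; inject₁; _<_)
open import Data.Fin.Properties using (opposite-prop; toℕ<n; toℕ-fromℕ; toℕ-inject₁)
open import Data.Fin.Permutation using (Permutation′; permutation; id; flip; _∘ₚ_; transpose; _⟨$⟩ʳ_)
open import Data.List using (List; []; _∷_; map; upTo; allFin)
open import Data.Nat.ListAction using (sum)
open import Data.Vec using (Vec; foldr′; reverse) renaming (map to vmap)
open import Data.Product using (_×_)
open import Relation.Binary.PropositionalEquality using (_≡_; refl; cong; subst; sym)
open import Relation.Nullary using (does)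
import Data.Nat as ℕ

-- Points 1,…,n are modelled by Fin n (point p ↔ index p-1).

infixl 7 _·_
infix 8 _⁻¹

-- Group operation in 𝔖_n: σ · τ  applies τ first (right factor first).
_·_ : ∀ {n} → Permutation′ n → Permutation′ n → Permutation′ n
σ · τ = τ ∘ₚ σ

_⁻¹ : ∀ {n} → Permutation′ n → Permutation′ n
σ ⁻¹ = flip σ

iter : ∀ {n} → ℕ → Permutation′ n → Fin n → Fin n
iter zero    σ i = i
iter (suc m) σ i = σ ⟨$⟩ʳ iter m σ i

and : List Bool → Bool
and []       = true
and (b ∷ bs) = b ∧ and bs

isCycleMin : ∀ {n} → Permutation′ n → Fin n → Bool
isCycleMin {n} σ i = and (map (λ m → does (toℕ i ℕ.≤? toℕ (iter m σ i))) (upTo n))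

-- number of cycles of σ (fixed points included): one minimum per cycle
cycles : ∀ {n} → Permutation′ n → ℕ
cycles {n} σ = sum (map (λ i → if isCycleMin σ i then 1 else 0) (allFin n))

∣_∣ : ∀ {n} → Permutation′ n → ℕ
∣_∣ {n} σ = n ∸ cycles σ

_≼_ : ∀ {n} → Permutation′ n → Permutation′ n → Set
σ₁ ≼ σ₂ = ∣ σ₂ ∣ ≡ ∣ σ₁ ∣ + ∣ (σ₁ ⁻¹) · σ₂ ∣

-- The long cycle (1 2 ⋯ n):  p ↦ p+1 for p < n,  n ↦ 1.

rot : ∀ {m} → Fin (suc m) → Fin (suc m)
rot {zero}  zero    = zero
rot {suc m} zero    = suc zero
rot {suc m} (suc i) with rot {m} i
... | zero  = zero
... | suc k = suc (suc k)

unrot : ∀ {m} → Fin (suc m) → Fin (suc m)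
unrot {zero}  zero          = zero
unrot {suc m} zero          = fromℕ (suc m)
unrot {suc m} (suc zero)    = zero
unrot {suc m} (suc (suc k)) = suc (unrot {m} (suc k))

rot-last : ∀ m → rot (fromℕ m) ≡ zero
rot-last zero = refl
rot-last (suc m) with rot {m} (fromℕ m) | rot-last m
... | zero | _ = refl

rot-inject : ∀ {m} (k : Fin (suc m)) → rot (inject₁ k) ≡ suc k
rot-inject {zero}  zero    = refl
rot-inject {suc m} zero    = refl
rot-inject {suc m} (suc k) with rot {suc m} (inject₁ k) | rot-inject k
... | .(suc k) | refl = refl

unrot-last : ∀ m → unrot {m} zero ≡ fromℕ m
unrot-last zero    = refl
unrot-last (suc m) = refl

unrot-suc : ∀ {m} (k : Fin (suc m)) → unrot {suc m} (suc k) ≡ inject₁ k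
unrot-suc {m}     zero    = refl
unrot-suc {suc m} (suc k) = cong suc (unrot-suc k)

rot-unrot : ∀ {m} (i : Fin (suc m)) → rot (unrot i) ≡ i
rot-unrot {zero}  zero    = refl
rot-unrot {suc m} zero    = rot-last (suc m)
rot-unrot {suc m} (suc k) = subst (λ x → rot x ≡ suc k) (sym (unrot-suc k)) (rot-inject k)

unrot-rot : ∀ {m} (i : Fin (suc m)) → unrot (rot i) ≡ i
unrot-rot {zero}  zero    = refl
unrot-rot {suc m} zero    = refl
unrot-rot {suc m} (suc i) with rot {m} i | unrot-rot {m} i
... | zero  | e = subst (λ x → fromℕ (suc m) ≡ suc x) (trans′ (unrot-last m) e) refl
  where
    trans′ : ∀ {A : Set} {a b c : A} → a ≡ b → a ≡ c → b ≡ c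
    trans′ refl refl = refl
... | suc k | e = cong suc e

longCycle : ∀ n → Permutation′ n
longCycle zero    = id
longCycle (suc m) = permutation rot unrot rot-unrot unrot-rot

record Transposition (n : ℕ) : Set where
  constructor ⟨_,_∣_⟩
  field
    i   : Fin n
    j   : Fin n
    i<j : i < j

toPerm : ∀ {n} → Transposition n → Permutation′ n
toPerm ⟨ i , j ∣ _ ⟩ = transpose i j

prod : ∀ {n k} → Vec (Transposition n) k → Permutation′ n
prod = foldr′ (λ τ π → toPerm τ · π) id

InΣ : ∀ n k → Vec (Transposition n) k → Set
InΣ n k τs = (∣ prod τs ∣ ≡ k) × (prod τs ≼ longCycle n)

-- (i j) ↦ (n+1−j  n+1−i);  on Fin n, p ↦ n+1−p is `opposite`.

opposite-< : ∀ {n} {i j : Fin n} → i < j → opposite j < opposite i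
opposite-< {n} {i} {j} i<j
  rewrite opposite-prop i | opposite-prop j = ∸-monoʳ-< (s≤s i<j) (toℕ<n j)

mirror : ∀ {n} → Transposition n → Transposition n
mirror ⟨ i , j ∣ p ⟩ = ⟨ opposite j , opposite i ∣ opposite-< p ⟩

module Submission where

-- Write w for the reflection p ↦ n+1−p of {1,…,n} and c for the long cycle (1 2 ⋯ n).
-- If π = τ₁ ⋯ τ_k, the reversed mirrored word has product π′ = w π⁻¹ w⁻¹, because
-- each mirrored transposition equals w τᵢ w⁻¹ = w τᵢ⁻¹ w⁻¹.  Moreover w c⁻¹ w⁻¹ = c, so
-- π′⁻¹ c = w (π c⁻¹) w⁻¹, and π c⁻¹ = (c (π⁻¹ c) c⁻¹)⁻¹.  Since the number of cycles
-- is invariant under conjugation and inversion, |π′| = |π| and |π′⁻¹ c| = |π⁻¹ c|,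
-- which is exactly what membership in Σₙ(k) asks for.

open import Defs
open import Data.Nat using (ℕ)
open import Data.Vec using (Vec; reverse; map)

open import Data.Nat using (zero; suc; _+_; _*_; _∸_; _≤_; _<_; _≤?_; s≤s; s≤s⁻¹)
import Data.Nat.Properties as ℕ
open import Data.Nat.DivMod using (_%_; _/_; m≡m%n+[m/n]*n; m%n<n)
open import Data.Nat.ListAction using () renaming (sum to listSum)
open import Data.Bool using (Bool; true; false; _∧_; if_then_else_)
import Data.Fin as Fin
open import Data.Fin using (Fin; toℕ; punchIn; _≟_; opposite; fromℕ; inject₁)
open import Data.Fin.Properties
  using (toℕ-injective; toℕ<n; pigeonhole; punchInᵢ≢i; opposite-involutive)
open import Data.Fin.Permutation using (Permutation′; _⟨$⟩ʳ_; _⟨$⟩ˡ_; inverseˡ; inverseʳ)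
import Data.Fin.Permutation as Perm
import Data.Fin.Permutation.Components as PC
open import Data.Vec using ([]; _∷_; _∷ʳ_)
open import Data.Vec.Properties using (reverse-∷)
import Data.List as List
open import Data.List using (List; []; _∷_)
open import Data.List.Membership.Propositional using (_∈_)
open import Data.List.Membership.Propositional.Properties using (∈-upTo⁺)
open import Data.List.Relation.Unary.Any using (here; there)
open import Algebra.Properties.CommutativeMonoid.Sum ℕ.+-0-commutativeMonoid
  using (sum; ∑-comm; sum-cong-≗; sum-remove; sum-replicate-zero)
open import Data.Product using (Σ; _×_; _,_; proj₁; proj₂)
open import Relation.Nullary using (¬_; Dec; yes; no; does; contradiction)
open import Relation.Nullary.Decidable using (dec-true)
open import Relation.Binary.PropositionalEquality
  using (_≡_; _≢_; refl; sym; trans; cong; cong₂; subst; module ≡-Reasoning)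

𝟙 : Bool → ℕ
𝟙 b = if b then 1 else 0

sum-tabulate : ∀ {A : Set} n (b : A → Bool) (g : Fin n → A) →
  listSum (List.map (λ x → 𝟙 (b x)) (List.tabulate g)) ≡ sum (λ i → 𝟙 (b (g i)))
sum-tabulate zero    b g = refl
sum-tabulate (suc n) b g = cong (𝟙 (b (g Fin.zero)) +_) (sum-tabulate n b (λ i → g (Fin.suc i)))

sum-𝟙-unique : ∀ {n} (b : Fin n → Bool) (i₀ : Fin n) → b i₀ ≡ true →
  (∀ i → b i ≡ true → i ≡ i₀) → sum (λ i → 𝟙 (b i)) ≡ 1
sum-𝟙-unique {suc n} b i₀ bi₀ unique = begin
  sum (λ i → 𝟙 (b i))                                ≡⟨ sum-remove {i = i₀} (λ i → 𝟙 (b i)) ⟩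
  𝟙 (b i₀) + sum (λ k → 𝟙 (b (punchIn i₀ k)))       ≡⟨ cong₂ _+_ (cong 𝟙 bi₀) (sum-cong-≗ off-i₀) ⟩
  1 + sum {n} (λ _ → 0)                              ≡⟨ cong suc (sum-replicate-zero n) ⟩
  1                                                  ∎
  where
  open ≡-Reasoning
  off-i₀ : ∀ k → 𝟙 (b (punchIn i₀ k)) ≡ 0
  off-i₀ k with b (punchIn i₀ k) in eq
  ... | false = refl
  ... | true  = contradiction (unique _ eq) (punchInᵢ≢i i₀ k)

𝟙-as-sum : ∀ {n} b (c : Fin n → Bool) → (b ≡ true → sum (λ j → 𝟙 (c j)) ≡ 1) →
  𝟙 b ≡ sum (λ j → 𝟙 (b ∧ c j))
𝟙-as-sum     true  c one = sym (one refl)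
𝟙-as-sum {n} false c one = sym (sum-replicate-zero n)

-- Double counting: if every i with P i is R-related to exactly one j with Q j and
-- vice versa, then P and Q hold equally often.  Both sides count the triples
-- P i ∧ Q j ∧ R i j.
double-count : ∀ {m n} (P : Fin m → Bool) (Q : Fin n → Bool) (R : Fin m → Fin n → Bool) →
  (∀ i → P i ≡ true → sum (λ j → 𝟙 (Q j ∧ R i j)) ≡ 1) →
  (∀ j → Q j ≡ true → sum (λ i → 𝟙 (P i ∧ R i j)) ≡ 1) →
  sum (λ i → 𝟙 (P i)) ≡ sum (λ j → 𝟙 (Q j))
double-count P Q R P-unique Q-unique = begin
  sum (λ i → 𝟙 (P i))
    ≡⟨ sum-cong-≗ (λ i → 𝟙-as-sum (P i) (λ j → Q j ∧ R i j) (P-unique i)) ⟩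
  sum (λ i → sum (λ j → 𝟙 (P i ∧ (Q j ∧ R i j))))
    ≡⟨ ∑-comm (λ i j → 𝟙 (P i ∧ (Q j ∧ R i j))) ⟩
  sum (λ j → sum (λ i → 𝟙 (P i ∧ (Q j ∧ R i j))))
    ≡⟨ sum-cong-≗ (λ j → sum-cong-≗ (λ i → cong 𝟙 (∧-swap (P i) (Q j) (R i j)))) ⟩
  sum (λ j → sum (λ i → 𝟙 (Q j ∧ (P i ∧ R i j))))
    ≡⟨ sum-cong-≗ (λ j → 𝟙-as-sum (Q j) (λ i → P i ∧ R i j) (Q-unique j)) ⟨
  sum (λ j → 𝟙 (Q j))
    ∎
  where
  open ≡-Reasoning
  ∧-swap : ∀ a b c → a ∧ (b ∧ c) ≡ b ∧ (a ∧ c)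
  ∧-swap true  b     c = refl
  ∧-swap false true  c = refl
  ∧-swap false false c = refl

does-true : ∀ {A : Set} (d : Dec A) → does d ≡ true → A
does-true (yes a) _ = a

does-false : ∀ {A : Set} (d : Dec A) → does d ≡ false → ¬ A
does-false (no ¬a) _ = ¬a

∧-true : ∀ {a b} → a ∧ b ≡ true → a ≡ true × b ≡ true
∧-true {true} {true} _ = refl , refl

∧-intro : ∀ {a b} → a ≡ true → b ≡ true → a ∧ b ≡ true
∧-intro refl refl = refl

and-map-true : ∀ {A : Set} (b : A → Bool) {xs : List A} {x} →
  and (List.map b xs) ≡ true → x ∈ xs → b x ≡ true
and-map-true b h (here refl) = proj₁ (∧-true h)
and-map-true b h (there x∈) = and-map-true b (proj₂ (∧-true h)) x∈

and-map-false : ∀ {A : Set} (b : A → Bool) (xs : List A) →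
  and (List.map b xs) ≡ false → Σ A λ x → b x ≡ false
and-map-false b []       ()
and-map-false b (x ∷ xs) h with b x in bx
... | false = x , bx
... | true  = and-map-false b xs h

⟨$⟩ʳ-injective : ∀ {n} (π : Permutation′ n) {x y} → π ⟨$⟩ʳ x ≡ π ⟨$⟩ʳ y → x ≡ y
⟨$⟩ʳ-injective π eq = trans (sym (inverseˡ π)) (trans (cong (π ⟨$⟩ˡ_) eq) (inverseˡ π))

module Orbit {n : ℕ} (σ : Permutation′ n) where

  iter-+ : ∀ a b i → iter (a + b) σ i ≡ iter a σ (iter b σ i)
  iter-+ zero    b i = refl
  iter-+ (suc a) b i = cong (σ ⟨$⟩ʳ_) (iter-+ a b i)

  iter-injective : ∀ a {x y} → iter a σ x ≡ iter a σ y → x ≡ y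
  iter-injective zero    eq = eq
  iter-injective (suc a) eq = iter-injective a (⟨$⟩ʳ-injective σ eq)

  -- Every point comes back after 1 ≤ p ≤ n steps: by pigeonhole two of
  -- σ⁰ i, …, σⁿ i coincide, and σ is injective.
  return-time : ∀ i → Σ ℕ λ p → (suc p ≤ n) × (iter (suc p) σ i ≡ i)
  return-time i with pigeonhole (ℕ.n<1+n n) (λ (a : Fin (suc n)) → iter (toℕ a) σ i)
  ... | a , b , a<b , eq with ℕ.m≤n⇒∃[o]m+o≡n a<b
  ... | d , a+d≡b = d , bound , iter-injective (toℕ a) (begin
        iter (toℕ a) σ (iter (suc d) σ i)  ≡⟨ iter-+ (toℕ a) (suc d) i ⟨
        iter (toℕ a + suc d) σ i           ≡⟨ cong (λ e → iter e σ i) (trans (ℕ.+-suc _ d) a+d≡b) ⟩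
        iter (toℕ b) σ i                   ≡⟨ eq ⟨
        iter (toℕ a) σ i                   ∎)
    where
    open ≡-Reasoning
    bound : suc d ≤ n
    bound = ℕ.≤-trans (s≤s (ℕ.m≤n+m d (toℕ a)))
                      (subst (_≤ n) (sym a+d≡b) (s≤s⁻¹ (toℕ<n b)))

  iter-periodic : ∀ p i → iter p σ i ≡ i → ∀ q → iter (q * p) σ i ≡ i
  iter-periodic p i back zero    = refl
  iter-periodic p i back (suc q) =
    trans (iter-+ p (q * p) i) (trans (cong (iter p σ) (iter-periodic p i back q)) back)

  iter-reduce : ∀ i m → Σ ℕ λ m′ → (m′ < n) × (iter m σ i ≡ iter m′ σ i)
  iter-reduce i m with return-time i
  ... | p , p≤n , back = m % suc p , ℕ.<-≤-trans (m%n<n m (suc p)) p≤n , (begin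
        iter m σ i
          ≡⟨ cong (λ e → iter e σ i) (m≡m%n+[m/n]*n m (suc p)) ⟩
        iter (m % suc p + m / suc p * suc p) σ i
          ≡⟨ iter-+ (m % suc p) (m / suc p * suc p) i ⟩
        iter (m % suc p) σ (iter (m / suc p * suc p) σ i)
          ≡⟨ cong (iter (m % suc p) σ) (iter-periodic (suc p) i back (m / suc p)) ⟩
        iter (m % suc p) σ i
          ∎)
    where open ≡-Reasoning

  _∼_ : Fin n → Fin n → Set
  i ∼ j = Σ ℕ λ m → iter m σ i ≡ j

  ∼-refl : ∀ {i} → i ∼ i
  ∼-refl = 0 , refl

  ∼-trans : ∀ {i j k} → i ∼ j → j ∼ k → i ∼ k
  ∼-trans {i} (m , refl) (m′ , refl) = m′ + m , iter-+ m′ m i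

  -- Going around the cycle of i, p times for each step taken, leads back.
  ∼-sym : ∀ {i j} → i ∼ j → j ∼ i
  ∼-sym {i} (m , refl) with return-time i
  ... | p , _ , back = m * p , (begin
        iter (m * p) σ (iter m σ i)  ≡⟨ iter-+ (m * p) m i ⟨
        iter (m * p + m) σ i         ≡⟨ cong (λ e → iter e σ i) m*p+m≡m*[1+p] ⟩
        iter (m * suc p) σ i         ≡⟨ iter-periodic (suc p) i back m ⟩
        i                            ∎)
    where
    open ≡-Reasoning
    m*p+m≡m*[1+p] : m * p + m ≡ m * suc p
    m*p+m≡m*[1+p] = trans (ℕ.+-comm (m * p) m) (sym (ℕ.*-suc m p))

  cycleMin-≤ : ∀ {i j} → isCycleMin σ i ≡ true → i ∼ j → toℕ i ≤ toℕ j
  cycleMin-≤ {i} isMin (m , refl) with iter-reduce i m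
  ... | m′ , m′<n , eq = subst (λ x → toℕ i ≤ toℕ x) (sym eq)
        (does-true (toℕ i ≤? _) (and-map-true _ {List.upTo n} isMin (∈-upTo⁺ m′<n)))

  cycleMin-unique : ∀ {i j} → isCycleMin σ i ≡ true → isCycleMin σ j ≡ true → i ∼ j → i ≡ j
  cycleMin-unique iMin jMin i∼j =
    toℕ-injective (ℕ.≤-antisym (cycleMin-≤ iMin i∼j) (cycleMin-≤ jMin (∼-sym i∼j)))

  smaller-in-orbit : ∀ {i} → isCycleMin σ i ≡ false →
    Σ (Fin n) λ j → (i ∼ j) × (toℕ j < toℕ i)
  smaller-in-orbit {i} notMin
    with and-map-false (λ m → does (toℕ i ≤? toℕ (iter m σ i))) (List.upTo n) notMin
  ... | m , i≰ = iter m σ i , (m , refl) , ℕ.≰⇒> (does-false (toℕ i ≤? _) i≰)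

  descend : ∀ bound i → toℕ i < bound → Σ (Fin n) λ j → (i ∼ j) × (isCycleMin σ j ≡ true)
  descend (suc bound) i (s≤s i≤bound) with isCycleMin σ i in isMin
  ... | true  = i , ∼-refl , isMin
  ... | false with smaller-in-orbit isMin
  ... | j , i∼j , j<i with descend bound j (ℕ.<-≤-trans j<i i≤bound)
  ... | k , j∼k , kMin = k , ∼-trans i∼j j∼k , kMin

  orbitMin : Fin n → Fin n
  orbitMin i = proj₁ (descend (suc (toℕ i)) i ℕ.≤-refl)

  orbitMin-isCycleMin : ∀ i → isCycleMin σ (orbitMin i) ≡ true
  orbitMin-isCycleMin i = proj₂ (proj₂ (descend (suc (toℕ i)) i ℕ.≤-refl))

  orbitMin-∼ : ∀ i → i ∼ orbitMin i
  orbitMin-∼ i = proj₁ (proj₂ (descend (suc (toℕ i)) i ℕ.≤-refl))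

  orbitMin-of : ∀ {i j} → isCycleMin σ j ≡ true → i ∼ j → orbitMin i ≡ j
  orbitMin-of jMin i∼j =
    cycleMin-unique (orbitMin-isCycleMin _) jMin (∼-trans (∼-sym (orbitMin-∼ _)) i∼j)

cycles-as-sum : ∀ {n} (σ : Permutation′ n) → cycles σ ≡ sum (λ i → 𝟙 (isCycleMin σ i))
cycles-as-sum {n} σ = sum-tabulate n (isCycleMin σ) (λ i → i)

-- If a bijection g carries the orbits of σ exactly onto the orbits of τ, then σ and τ
-- have equally many cycles: i ↦ orbitMin τ (g i) matches the cycle minima of σ
-- one-to-one with those of τ, and double counting concludes.
cycles-transport : ∀ {n} (σ τ g : Permutation′ n) →
  (∀ {i j} → Orbit._∼_ σ i j → Orbit._∼_ τ (g ⟨$⟩ʳ i) (g ⟨$⟩ʳ j)) →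
  (∀ {i j} → Orbit._∼_ τ (g ⟨$⟩ʳ i) (g ⟨$⟩ʳ j) → Orbit._∼_ σ i j) →
  cycles σ ≡ cycles τ
cycles-transport {n} σ τ g orbit⇒ orbit⇐ = begin
  cycles σ                           ≡⟨ cycles-as-sum σ ⟩
  sum (λ i → 𝟙 (isCycleMin σ i))     ≡⟨ double-count _ _ matched σ-side τ-side ⟩
  sum (λ j → 𝟙 (isCycleMin τ j))     ≡⟨ cycles-as-sum τ ⟨
  cycles τ                           ∎
  where
  open ≡-Reasoning
  module S = Orbit σ
  module T = Orbit τ

  matched : Fin n → Fin n → Bool
  matched i j = does (T.orbitMin (g ⟨$⟩ʳ i) ≟ j)

  σ-side : ∀ i → isCycleMin σ i ≡ true → sum (λ j → 𝟙 (isCycleMin τ j ∧ matched i j)) ≡ 1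
  σ-side i _ = sum-𝟙-unique _ (T.orbitMin (g ⟨$⟩ʳ i))
    (∧-intro (T.orbitMin-isCycleMin _) (dec-true (T.orbitMin (g ⟨$⟩ʳ i) ≟ _) refl))
    (λ j h → sym (does-true (_ ≟ j) (proj₂ (∧-true h))))

  τ-side : ∀ j → isCycleMin τ j ≡ true → sum (λ i → 𝟙 (isCycleMin σ i ∧ matched i j)) ≡ 1
  τ-side j jMin = sum-𝟙-unique _ i₀
    (∧-intro (S.orbitMin-isCycleMin _)
             (dec-true (T.orbitMin (g ⟨$⟩ʳ i₀) ≟ j) (T.orbitMin-of jMin gi₀∼j)))
    unique
    where
    i₀ : Fin n
    i₀ = S.orbitMin (g ⟨$⟩ˡ j)
    -- i₀ is in the σ-orbit of g⁻¹ j, so g i₀ is in the τ-orbit of j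
    gi₀∼j : T._∼_ (g ⟨$⟩ʳ i₀) j
    gi₀∼j = subst (T._∼_ (g ⟨$⟩ʳ i₀)) (inverseʳ g) (orbit⇒ (S.∼-sym (S.orbitMin-∼ _)))
    unique : ∀ i → (isCycleMin σ i ∧ matched i j) ≡ true → i ≡ i₀
    unique i h with ∧-true h
    ... | iMin , hit =
      S.cycleMin-unique iMin (S.orbitMin-isCycleMin _) (orbit⇐ (T.∼-trans gi∼j (T.∼-sym gi₀∼j)))
      where
      gi∼j : T._∼_ (g ⟨$⟩ʳ i) j
      gi∼j = subst (T._∼_ (g ⟨$⟩ʳ i)) (does-true (T.orbitMin (g ⟨$⟩ʳ i) ≟ j) hit) (T.orbitMin-∼ _)

-- `Conjugates g σ τ`: τ ∘ g = g ∘ σ, i.e. τ = g σ g⁻¹.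
Conjugates : ∀ {n} → Permutation′ n → Permutation′ n → Permutation′ n → Set
Conjugates {n} g σ τ = ∀ (x : Fin n) → τ ⟨$⟩ʳ (g ⟨$⟩ʳ x) ≡ g ⟨$⟩ʳ (σ ⟨$⟩ʳ x)

conj-inverse : ∀ {n} {g σ τ : Permutation′ n} → Conjugates g σ τ → Conjugates g (σ ⁻¹) (τ ⁻¹)
conj-inverse {g = g} {σ} {τ} conj x = begin
  τ ⟨$⟩ˡ (g ⟨$⟩ʳ x)                          ≡⟨ cong (λ y → τ ⟨$⟩ˡ (g ⟨$⟩ʳ y)) (inverseʳ σ) ⟨
  τ ⟨$⟩ˡ (g ⟨$⟩ʳ (σ ⟨$⟩ʳ (σ ⟨$⟩ˡ x)))        ≡⟨ cong (τ ⟨$⟩ˡ_) (conj (σ ⟨$⟩ˡ x)) ⟨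
  τ ⟨$⟩ˡ (τ ⟨$⟩ʳ (g ⟨$⟩ʳ (σ ⟨$⟩ˡ x)))        ≡⟨ inverseˡ τ ⟩
  g ⟨$⟩ʳ (σ ⟨$⟩ˡ x)                          ∎
  where open ≡-Reasoning

conj-· : ∀ {n} {g σ σ′ τ τ′ : Permutation′ n} →
  Conjugates g σ τ → Conjugates g σ′ τ′ → Conjugates g (σ · σ′) (τ · τ′)
conj-· {τ = τ} conj conj′ x = trans (cong (τ ⟨$⟩ʳ_) (conj′ x)) (conj _)

cycles-conj : ∀ {n} (g σ τ : Permutation′ n) → Conjugates g σ τ → cycles σ ≡ cycles τ
cycles-conj g σ τ conj = cycles-transport σ τ g
  (λ { (m , refl) → m , iter-conj m _ })
  (λ { (m , eq) → m , ⟨$⟩ʳ-injective g (trans (sym (iter-conj m _)) eq) })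
  where
  iter-conj : ∀ m x → iter m τ (g ⟨$⟩ʳ x) ≡ g ⟨$⟩ʳ iter m σ x
  iter-conj zero    x = refl
  iter-conj (suc m) x = trans (cong (τ ⟨$⟩ʳ_) (iter-conj m x)) (conj _)

iter-cancel : ∀ {n} (α β : Permutation′ n) → (∀ x → α ⟨$⟩ʳ (β ⟨$⟩ʳ x) ≡ x) →
  ∀ m x → iter m α (iter m β x) ≡ x
iter-cancel α β cancel zero    x = refl
iter-cancel α β cancel (suc m) x = begin
  iter (suc m) α (β ⟨$⟩ʳ iter m β x)     ≡⟨ cong (λ e → iter e α (β ⟨$⟩ʳ iter m β x)) (ℕ.+-comm 1 m) ⟩
  iter (m + 1) α (β ⟨$⟩ʳ iter m β x)     ≡⟨ Orbit.iter-+ α m 1 _ ⟩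
  iter m α (α ⟨$⟩ʳ (β ⟨$⟩ʳ iter m β x))  ≡⟨ cong (iter m α) (cancel _) ⟩
  iter m α (iter m β x)                  ≡⟨ iter-cancel α β cancel m x ⟩
  x                                      ∎
  where open ≡-Reasoning

-- σ and σ⁻¹ have the same orbits, hence the same number of cycles.
cycles-inverse : ∀ {n} (σ : Permutation′ n) → cycles (σ ⁻¹) ≡ cycles σ
cycles-inverse σ = cycles-transport (σ ⁻¹) σ Perm.id
  (λ { (m , refl) → Orbit.∼-sym σ (m , iter-cancel σ (σ ⁻¹) (λ _ → inverseʳ σ) m _) })
  (λ { (m , refl) → Orbit.∼-sym (σ ⁻¹) (m , iter-cancel (σ ⁻¹) σ (λ _ → inverseˡ σ) m _) })

module _ {n : ℕ} {i j k : Fin n} where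

  transpose-at-i : k ≡ i → PC.transpose i j k ≡ j
  transpose-at-i k≡i with k ≟ i
  ... | yes _   = refl
  ... | no k≢i  = contradiction k≡i k≢i

  transpose-at-j : k ≢ i → k ≡ j → PC.transpose i j k ≡ i
  transpose-at-j k≢i k≡j with k ≟ i
  ... | yes k≡i = contradiction k≡i k≢i
  ... | no _ with k ≟ j
  ...   | yes _   = refl
  ...   | no k≢j  = contradiction k≡j k≢j

  transpose-elsewhere : k ≢ i → k ≢ j → PC.transpose i j k ≡ k
  transpose-elsewhere k≢i k≢j with k ≟ i
  ... | yes k≡i = contradiction k≡i k≢i
  ... | no _ with k ≟ j
  ...   | yes k≡j = contradiction k≡j k≢j
  ...   | no _    = refl

transpose-relabel : ∀ {m n} (f : Fin m → Fin n) → (∀ {x y} → f x ≡ f y → x ≡ y) →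
  ∀ a b y → PC.transpose (f a) (f b) (f y) ≡ f (PC.transpose a b y)
transpose-relabel f f-inj a b y = by-cases (y ≟ a) (y ≟ b)
  where
  by-cases : Dec (y ≡ a) → Dec (y ≡ b) → PC.transpose (f a) (f b) (f y) ≡ f (PC.transpose a b y)
  by-cases (yes y≡a) _ =
    trans (transpose-at-i (cong f y≡a)) (cong f (sym (transpose-at-i y≡a)))
  by-cases (no y≢a) (yes y≡b) =
    trans (transpose-at-j (λ e → y≢a (f-inj e)) (cong f y≡b)) (cong f (sym (transpose-at-j y≢a y≡b)))
  by-cases (no y≢a) (no y≢b) =
    trans (transpose-elsewhere (λ e → y≢a (f-inj e)) (λ e → y≢b (f-inj e)))
          (cong f (sym (transpose-elsewhere y≢a y≢b)))

opposite-injective : ∀ {n} {x y : Fin n} → opposite x ≡ opposite y → x ≡ y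
opposite-injective {x = x} {y} eq =
  trans (sym (opposite-involutive x)) (trans (cong opposite eq) (opposite-involutive y))

mirror-transposition : ∀ {n} (t : Transposition n) y →
  toPerm (mirror t) ⟨$⟩ʳ opposite y ≡ opposite (toPerm t ⟨$⟩ˡ y)
mirror-transposition ⟨ i , j ∣ _ ⟩ y = transpose-relabel opposite opposite-injective j i y

prod-∷ʳ : ∀ {n k} (τs : Vec (Transposition n) k) t x →
  prod (τs ∷ʳ t) ⟨$⟩ʳ x ≡ prod τs ⟨$⟩ʳ (toPerm t ⟨$⟩ʳ x)
prod-∷ʳ []       t x = refl
prod-∷ʳ (τ ∷ τs) t x = cong (toPerm τ ⟨$⟩ʳ_) (prod-∷ʳ τs t x)

-- By induction, peeling the first factor τ of the
-- word, which becomes the last (rightmost) factor of the mirrored word.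
mirror-prod : ∀ {n k} (τs : Vec (Transposition n) k) →
  Conjugates Perm.reverse (prod τs ⁻¹) (prod (reverse (map mirror τs)))
mirror-prod []       x = refl
mirror-prod (t ∷ τs) x = begin
  prod (reverse (mirror t ∷ map mirror τs)) ⟨$⟩ʳ opposite x
    ≡⟨ cong (λ v → prod v ⟨$⟩ʳ opposite x) (reverse-∷ (mirror t) (map mirror τs)) ⟩
  prod (reverse (map mirror τs) ∷ʳ mirror t) ⟨$⟩ʳ opposite x
    ≡⟨ prod-∷ʳ (reverse (map mirror τs)) (mirror t) (opposite x) ⟩
  prod (reverse (map mirror τs)) ⟨$⟩ʳ (toPerm (mirror t) ⟨$⟩ʳ opposite x)
    ≡⟨ cong (prod (reverse (map mirror τs)) ⟨$⟩ʳ_) (mirror-transposition t x) ⟩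
  prod (reverse (map mirror τs)) ⟨$⟩ʳ opposite (toPerm t ⟨$⟩ˡ x)
    ≡⟨ mirror-prod τs (toPerm t ⟨$⟩ˡ x) ⟩
  opposite (prod τs ⟨$⟩ˡ (toPerm t ⟨$⟩ˡ x))
    ∎
  where open ≡-Reasoning

opposite-fromℕ : ∀ m → opposite (fromℕ m) ≡ Fin.zero
opposite-fromℕ zero    = refl
opposite-fromℕ (suc m) = cong inject₁ (opposite-fromℕ m)

opposite-inject₁ : ∀ {m} (k : Fin (suc m)) → opposite (inject₁ k) ≡ Fin.suc (opposite k)
opposite-inject₁ Fin.zero    = refl
opposite-inject₁ {suc m} (Fin.suc k) = cong inject₁ (opposite-inject₁ k)

longCycle-mirror : ∀ n → Conjugates Perm.reverse (longCycle n ⁻¹) (longCycle n)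
longCycle-mirror (suc m) Fin.zero = begin
  rot (fromℕ m)          ≡⟨ rot-last m ⟩
  Fin.zero               ≡⟨ opposite-fromℕ m ⟨
  opposite (fromℕ m)     ≡⟨ cong opposite (unrot-last m) ⟨
  opposite (unrot Fin.zero) ∎
  where open ≡-Reasoning
longCycle-mirror (suc (suc m)) (Fin.suc k) = begin
  rot (inject₁ (opposite k))     ≡⟨ rot-inject (opposite k) ⟩
  Fin.suc (opposite k)           ≡⟨ opposite-inject₁ k ⟨
  opposite (inject₁ k)           ≡⟨ cong opposite (unrot-suc k) ⟨
  opposite (unrot (Fin.suc k))   ∎
  where open ≡-Reasoning

-- With w the reflection p ↦ n+1−p, c the long cycle, π a permutation and π′ = w π⁻¹ w⁻¹:
-- π′ has as many cycles as π, and π′⁻¹ c as many as π⁻¹ c, since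
-- π′⁻¹ c = w (π c⁻¹) w⁻¹ and π c⁻¹ = (c (π⁻¹ c) c⁻¹)⁻¹.
reflected-cycles : ∀ {n} (π π′ : Permutation′ n) → Conjugates Perm.reverse (π ⁻¹) π′ →
  (cycles π′ ≡ cycles π) × (cycles ((π′ ⁻¹) · longCycle n) ≡ cycles ((π ⁻¹) · longCycle n))
reflected-cycles {n} π π′ π′-reflects =
  trans (sym (cycles-conj Perm.reverse (π ⁻¹) π′ π′-reflects)) (cycles-inverse π) ,
  (begin
    cycles ((π′ ⁻¹) · c)      ≡⟨ cycles-conj Perm.reverse _ _ reflected-quotient ⟨
    cycles (π · (c ⁻¹))       ≡⟨ cycles-inverse (π · (c ⁻¹)) ⟨
    cycles ((π · (c ⁻¹)) ⁻¹)  ≡⟨ cycles-conj c _ _ inverted-quotient ⟨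
    cycles ((π ⁻¹) · c)       ∎)
  where
  open ≡-Reasoning
  c : Permutation′ n
  c = longCycle n

  reflected-quotient : Conjugates Perm.reverse (π · (c ⁻¹)) ((π′ ⁻¹) · c)
  reflected-quotient = conj-· {g = Perm.reverse} {π} {c ⁻¹} {π′ ⁻¹} {c}
    (conj-inverse {g = Perm.reverse} {π ⁻¹} {π′} π′-reflects) (longCycle-mirror n)

  -- (π c⁻¹)⁻¹ = c⁻¹⁻¹ π⁻¹ = c (π⁻¹ c) c⁻¹, pointwise by computation
  inverted-quotient : Conjugates c ((π ⁻¹) · c) ((π · (c ⁻¹)) ⁻¹)
  inverted-quotient _ = refl

lemma3p3 : ∀ (n k : ℕ) (τs : Vec (Transposition n) k) →
    InΣ n k τs → InΣ n k (reverse (map mirror τs))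
lemma3p3 n k τs (length-k , below-c) =
  trans (cong (n ∸_) (proj₁ mirrored-cycles)) length-k ,
  trans below-c (sym (cong₂ _+_ (cong (n ∸_) (proj₁ mirrored-cycles))
                                (cong (n ∸_) (proj₂ mirrored-cycles))))
  where
  mirrored-cycles : (cycles (prod (reverse (map mirror τs))) ≡ cycles (prod τs)) ×
                    (cycles ((prod (reverse (map mirror τs)) ⁻¹) · longCycle n)
                      ≡ cycles ((prod τs ⁻¹) · longCycle n))
  mirrored-cycles = reflected-cycles (prod τs) (prod (reverse (map mirror τs))) (mirror-prod τs)
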